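{- Let $\mathcal{K}$ be the set of conflicting pairs defined in the context. Every feasible solution $(x,y,f,\varphi)$ of $\mathcal{F}_2$ satisfies $$\sum_{e\in\delta^-(V)}x_e\ \ge\ y_i+y_j\quad\text{for all }\langle i,j\rangle\in\mathcal{K}\text{ and all }V\subseteq N\setminus\{s\}\text{ with }\{i,j\}\subseteq V.$$
   Context: Setting (Steiner Team Orienteering Problem). $G=(N,A)$ is a digraph with distinct vertices $s,t\in N$; $N\setminus\{s,t\}$ is partitioned into disjoint sets $S$ (mandatory vertices) and $P$ (profitable vertices). Each $i\in P$ has a reward $p_i\in\mathbb{Z}^+$, each arc $(i,j)\in A$ has a positive real traverse time $d_{ij}\in\mathbb{R}^+$, $m$ is a positive integer (number of vehicles) and $T$ is a time limit. For $i\in N$, $\delta^+(i)=\{j\in N:(i,j)\in A\}$ and $\delta^-(i)=\{j\in N:(j,i)\in A\}$; for $V\subseteq N$, $\delta^+(V)$ (resp. $\delta^-(V)$) is the set of arcs $(i,j)\in A$ with $i\in V,j\notin V$ (resp. $i\notin V,j\in V$). For $i,j\in N$, $R_{ij}$ is the minimum total traverse time of a directed path from $i$ to $j$ in $G$, with $R_{ii}=0$. A route is a directed path from $s$ to $t$ in $G$ visiting each vertex at most once; its traverse time is the sum of $d$ over its arcs. $\mathcal{K}$ is the set of pairs $\langle i,j\rangle$ of distinct vertices $i,j\in N\setminus\{s,t\}$ such that every route visiting both $i$ and $j$ (in either order) has traverse time exceeding $T$. $\mathcal{F}_2$: maximize $\sum_{i\in P}p_iy_i$ over variables $x_{ij}$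 ($(i,j)\in A$), $y_i$ ($i\in N$), $f_{ij}$ ($(i,j)\in A$), $\varphi$, subject to: $y_i=1$ for all $i\in S\cup\{s,t\}$; $\sum_{j\in\delta^+(i)}x_{ij}=y_i$ for all $i\in S\cup P$; $\sum_{j\in\delta^+(s)}x_{sj}=\sum_{i\in\delta^-(t)}x_{it}=m-\varphi$; $\sum_{i\in\delta^-(s)}x_{is}=\sum_{j\in\delta^+(t)}x_{tj}=0$; $\sum_{j\in\delta^+(i)}x_{ij}-\sum_{j\in\delta^-(i)}x_{ji}=0$ for all $i\in S\cup P$; $f_{sj}=(T-d_{sj})x_{sj}$ for all $j\in\delta^+(s)$; $\sum_{j\in\delta^-(i)}f_{ji}-\sum_{j\in\delta^+(i)}f_{ij}=\sum_{j\in\delta^+(i)}d_{ij}x_{ij}$ for all $i\in S\cup P$; $f_{ij}\le (T-R_{si}-d_{ij})x_{ij}$ for all $(i,j)\in A$ with $i\ne s$; $f_{ij}\ge R_{jt}x_{ij}$ for all $(i,j)\in A$; $x\in\{0,1\}^A$, $y\in\{0,1\}^N$, $f\ge0$, $0\le\varphi\le m$. -}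

module Defs where

open import Level using (Level; _⊔_) renaming (suc to lsuc)
open import Data.Bool using (Bool; true; false; if_then_else_; not; _∧_)
open import Data.Nat using (ℕ; zero; suc)
open import Data.Fin using (Fin) renaming (zero to fzero; suc to fsuc)
open import Data.List using (List; []; _∷_; head; last)
open import Data.List.Relation.Unary.Unique.Propositional using (Unique)
open import Data.List.Relation.Unary.Linked using (Linked)
open import Data.List.Membership.Propositional using (_∈_)
open import Data.Maybe using (just)
open import Data.Product using (_×_; Σ)
open import Data.Sum using (_⊎_)
open import Relation.Binary.PropositionalEquality using (_≡_; _≢_)
open import Relation.Nullary using (¬_)
open import Algebra.Bundles using (CommutativeRing)

-- Ordered fields (the standard library has no real numbers; the
-- theorem is stated for an arbitrary ordered field, ℝ being one).

record OrderedField (c ℓ₁ ℓ₂ : Level) : Set (lsuc (c ⊔ ℓ₁ ⊔ ℓ₂)) where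
  field
    commRing : CommutativeRing c ℓ₁
  open CommutativeRing commRing public
  field
    _≤_       : Carrier → Carrier → Set ℓ₂
    ≤-refl    : ∀ {x y} → x ≈ y → x ≤ y
    ≤-antisym : ∀ {x y} → x ≤ y → y ≤ x → x ≈ y
    ≤-trans   : ∀ {x y z} → x ≤ y → y ≤ z → x ≤ z
    ≤-total   : ∀ x y → (x ≤ y) ⊎ (y ≤ x)
    ≤-resp-≈  : ∀ {x x' y y'} → x ≈ x' → y ≈ y' → x ≤ y → x' ≤ y'
    +-mono-≤  : ∀ {x y} z → x ≤ y → (x + z) ≤ (y + z)
    *-nonneg  : ∀ {x y} → 0# ≤ x → 0# ≤ y → 0# ≤ (x * y)
    0≉1       : ¬ (0# ≈ 1#)
    inverse   : ∀ x → ¬ (x ≈ 0#) → Σ Carrier (λ z → (x * z) ≈ 1#)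

  _<_ : Carrier → Carrier → Set (ℓ₁ ⊔ ℓ₂)
  x < y = (x ≤ y) × ¬ (x ≈ y)

  ι : ℕ → Carrier
  ι zero    = 0#
  ι (suc k) = 1# + ι k

  ⟦_⟧ : Bool → Carrier
  ⟦ b ⟧ = if b then 1# else 0#

  ∑ : ∀ {n} → (Fin n → Carrier) → Carrier
  ∑ {zero}  g = 0#
  ∑ {suc n} g = g fzero + ∑ (λ i → g (fsuc i))

-- Vertex set N = Fin n; the arc set A is given by the Boolean relation
-- `arc`; `mand i ≡ true` means i ∈ S, `mand i ≡ false` means i ∈ P
-- (for i ∉ {s,t}).  The 0/1 variables x, y are Booleans.

module STOP {c ℓ₁ ℓ₂} (F : OrderedField c ℓ₁ ℓ₂) {n : ℕ}
            (arc : Fin n → Fin n → Bool) (d : Fin n → Fin n → OrderedField.Carrier F)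
            (s t : Fin n) where
  open OrderedField F

  IsPath : List (Fin n) → Set
  IsPath ps = Unique ps × Linked (λ a b → arc a b ≡ true) ps

  PathFromTo : Fin n → Fin n → List (Fin n) → Set
  PathFromTo i j ps = IsPath ps × head ps ≡ just i × last ps ≡ just j

  time : List (Fin n) → Carrier
  time []            = 0#
  time (a ∷ [])      = 0#
  time (a ∷ b ∷ ps)  = d a b + time (b ∷ ps)

  IsMinTime : Fin n → Fin n → Carrier → Set (ℓ₁ ⊔ ℓ₂)
  IsMinTime i j r =
    Σ (List (Fin n)) (λ ps → PathFromTo i j ps × time ps ≈ r)
    × (∀ ps → PathFromTo i j ps → r ≤ time ps)

  IsRoute : List (Fin n) → Set
  IsRoute = PathFromTo s t

  Conflicting : Carrier → Fin n → Fin n → Set (ℓ₁ ⊔ ℓ₂)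
  Conflicting T i j =
    i ≢ s × i ≢ t × j ≢ s × j ≢ t × i ≢ j
    × (∀ ps → IsRoute ps → i ∈ ps → j ∈ ps → T < time ps)

  out∑ : (Fin n → Fin n → Carrier) → Fin n → Carrier
  out∑ g i = ∑ (λ j → if arc i j then g i j else 0#)

  in∑ : (Fin n → Fin n → Carrier) → Fin n → Carrier
  in∑ g i = ∑ (λ j → if arc j i then g j i else 0#)

  cutIn : (Fin n → Bool) → (Fin n → Fin n → Bool) → Carrier
  cutIn V x = ∑ (λ a → ∑ (λ b → if arc a b ∧ not (V a) ∧ V b then ⟦ x a b ⟧ else 0#))

  record Feasible (mand : Fin n → Bool) (m : ℕ) (T : Carrier)
                  (R : Fin n → Fin n → Carrier)
                  (x : Fin n → Fin n → Bool) (y : Fin n → Bool)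
                  (f : Fin n → Fin n → Carrier) (φ : Carrier) : Set (c ⊔ ℓ₁ ⊔ ℓ₂) where
    X : Fin n → Fin n → Carrier
    X a b = ⟦ x a b ⟧
    field
      y-s      : y s ≡ true
      y-t      : y t ≡ true
      y-S      : ∀ i → i ≢ s → i ≢ t → mand i ≡ true → y i ≡ true
      degree   : ∀ i → i ≢ s → i ≢ t → out∑ X i ≈ ⟦ y i ⟧
      out-s    : out∑ X s ≈ (ι m - φ)
      in-t     : in∑ X t ≈ (ι m - φ)
      in-s     : in∑ X s ≈ 0#
      out-t    : out∑ X t ≈ 0#
      balance  : ∀ i → i ≢ s → i ≢ t → (out∑ X i - in∑ X i) ≈ 0#
      f-s      : ∀ j → arc s j ≡ true → f s j ≈ ((T - d s j) * X s j)
      f-cons   : ∀ i → i ≢ s → i ≢ t →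
                   (in∑ f i - out∑ f i) ≈ out∑ (λ a b → d a b * X a b) i
      f-upper  : ∀ i j → arc i j ≡ true → i ≢ s → f i j ≤ ((T - R s i - d i j) * X i j)
      f-lower  : ∀ i j → arc i j ≡ true → (R j t * X i j) ≤ f i j
      f-nonneg : ∀ i j → arc i j ≡ true → 0# ≤ f i j
      φ-nonneg : 0# ≤ φ
      φ-le-m   : φ ≤ ι m

{-# OPTIONS --safe #-}
-- In a feasible solution every visited vertex (y = 1, other than s and t) has exactly one used
-- in-arc and one used out-arc, and by flow conservation f drops by d > 0 across it. So f strictly
-- decreases along used arcs, and following them from a visited vertex u, forwards and backwards,
-- never repeats a vertex: u lies on a route s w … t of used arcs, whose traverse time is at most
-- d_{sw} + f_{sw} = T. This route leaves s ∉ V and visits u ∈ V, so it uses an arc entering V.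
-- If y_i = y_j = 1 the routes through i and j enter V by different arcs: used arcs determine the
-- walk after a common entry arc, which would put i and j on one route of time at most T,
-- contradicting ⟨i,j⟩ ∈ 𝒦.
module Submission where

open import Defs
open import Level using (Level)
open import Data.Bool using (Bool; true; false; if_then_else_; not; _∧_)
open import Data.Bool.Properties using (¬-not)
import Data.Bool.Properties as Bool
open import Data.Nat using (ℕ; zero; suc) renaming (_≤_ to _≤ℕ_; _<_ to _<ℕ_)
import Data.Nat as ℕ
import Data.Nat.Properties as ℕₚ
open import Data.Fin using (Fin; _≟_) renaming (zero to fzero; suc to fsuc)
open import Data.Fin.Properties using (any?; suc-injective; injective⇒≤)
open import Data.List using (List; []; _∷_; length; lookup; last)
open import Data.List.Membership.Propositional using (_∈_)
open import Data.List.Membership.Propositional.Properties using (∈-lookup)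
open import Data.List.Relation.Binary.Subset.Propositional using (_⊆_)
import Data.List.Relation.Unary.All as All
open import Data.List.Relation.Unary.AllPairs using ([]; _∷_)
open import Data.List.Relation.Unary.Any using (here; there)
open import Data.List.Relation.Unary.Linked using (Linked; [-]; _∷_)
open import Data.List.Relation.Unary.Unique.Propositional using (Unique)
open import Data.Maybe using (just)
open import Data.Product as Product using (∃; ∃₂; _×_; _,_; proj₁; proj₂)
open import Data.Sum as Sum using (_⊎_; inj₁; inj₂)
open import Data.Unit using (⊤; tt)
open import Function using (_∘_)
open import Relation.Binary.Bundles using (Poset)
open import Relation.Nullary using (¬_; Dec; yes; no; contradiction)
open import Relation.Nullary.Decidable using (_×-dec_)
open import Relation.Binary.PropositionalEquality as ≡ using (_≡_; _≢_; refl)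
import Algebra.Properties.Group as GroupProperties
import Algebra.Properties.Ring as RingProperties
import Relation.Binary.Construct.NonStrictToStrict as Strict

Unique⇒lookup-injective : ∀ {a} {A : Set a} {xs : List A} → Unique xs →
                          ∀ {i j} → lookup xs i ≡ lookup xs j → i ≡ j
Unique⇒lookup-injective (_ ∷ _)    {fzero}  {fzero}  _  = refl
Unique⇒lookup-injective (x∉ ∷ _)   {fzero}  {fsuc j} eq = contradiction eq (All.lookup x∉ (∈-lookup j))
Unique⇒lookup-injective (x∉ ∷ _)   {fsuc i} {fzero}  eq = contradiction (≡.sym eq) (All.lookup x∉ (∈-lookup i))
Unique⇒lookup-injective (_ ∷ uniq) {fsuc i} {fsuc j} eq = ≡.cong fsuc (Unique⇒lookup-injective uniq eq)

Unique⇒length≤ : ∀ {n} {xs : List (Fin n)} → Unique xs → length xs ≤ℕ n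
Unique⇒length≤ uniq = injective⇒≤ (Unique⇒lookup-injective uniq)

module OrderedFieldProperties {c ℓ₁ ℓ₂} (F : OrderedField c ℓ₁ ℓ₂) where
  open OrderedField F renaming (refl to ≈-refl; sym to ≈-sym; trans to ≈-trans)
  open RingProperties ring using (-1*x≈-x; -‿involutive)
  open GroupProperties +-group using (identityʳ-unique; //-rightDividesˡ)
  open GroupProperties +-group public using (x∙y⁻¹≈ε⇒x≈y)

  poset : Poset c ℓ₁ ℓ₂
  poset = record
    { isPartialOrder = record
      { isPreorder = record { isEquivalence = isEquivalence ; reflexive = ≤-refl ; trans = ≤-trans }
      ; antisym = ≤-antisym } }

  open import Relation.Binary.Reasoning.PartialOrder poset public

  <⇒≱ : ∀ {x y} → x < y → ¬ (y ≤ x)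
  <⇒≱ = Strict.<⇒≱ _≈_ _≤_ ≤-antisym

  +-monoʳ-≤ : ∀ z {x y} → x ≤ y → (z + x) ≤ (z + y)
  +-monoʳ-≤ z {x} {y} x≤y = begin
    z + x ≈⟨ +-comm z x ⟩
    x + z ≤⟨ +-mono-≤ z x≤y ⟩
    y + z ≈⟨ +-comm y z ⟩
    z + y ∎

  +-mono₂-≤ : ∀ {x x′ y y′} → x ≤ x′ → y ≤ y′ → (x + y) ≤ (x′ + y′)
  +-mono₂-≤ {x′ = x′} {y} x≤x′ y≤y′ = ≤-trans (+-mono-≤ y x≤x′) (+-monoʳ-≤ x′ y≤y′)

  0≤x+y : ∀ {x y} → 0# ≤ x → 0# ≤ y → 0# ≤ (x + y)
  0≤x+y 0≤x 0≤y = ≤-trans (≤-refl (≈-sym (+-identityʳ 0#))) (+-mono₂-≤ 0≤x 0≤y)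

  -- If 1 ≤ 0 then 0 ≤ -1, so 0 ≤ (-1)(-1) = 1.
  0≤1 : 0# ≤ 1#
  0≤1 with ≤-total 0# 1#
  ... | inj₁ 0≤1 = 0≤1
  ... | inj₂ 1≤0 = contradiction (≤-antisym 0≤1′ 1≤0) 0≉1
    where
    0≤-1 : 0# ≤ (- 1#)
    0≤-1 = ≤-resp-≈ (-‿inverseʳ 1#) (+-identityˡ (- 1#)) (+-mono-≤ (- 1#) 1≤0)
    0≤1′ : 0# ≤ 1#
    0≤1′ = ≤-resp-≈ ≈-refl (≈-trans (-1*x≈-x (- 1#)) (-‿involutive 1#)) (*-nonneg 0≤-1 0≤-1)

  0<1 : 0# < 1#
  0<1 = 0≤1 , 0≉1

  x<x+y : ∀ {x y} → 0# < y → x < (x + y)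
  x<x+y {x} {y} (0≤y , 0≉y) = ≤-trans (≤-refl (≈-sym (+-identityʳ x))) (+-monoʳ-≤ x 0≤y) ,
                               λ x≈x+y → 0≉y (≈-sym (identityʳ-unique x y (≈-sym x≈x+y)))

  1<1+1 : 1# < (1# + 1#)
  1<1+1 = x<x+y 0<1

  x-y≈z⇒x≈y+z : ∀ {x y z} → x - y ≈ z → x ≈ y + z
  x-y≈z⇒x≈y+z {x} {y} {z} x-y≈z = begin-equality
    x           ≈⟨ //-rightDividesˡ y x ⟨
    (x - y) + y ≈⟨ +-congʳ x-y≈z ⟩
    z + y       ≈⟨ +-comm z y ⟩
    y + z       ∎

  x+[y-x]≈y : ∀ x y → x + (y - x) ≈ y
  x+[y-x]≈y x y = ≈-trans (+-comm x (y - x)) (//-rightDividesˡ x y)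

  x*⟦b⟧≈0 : ∀ z {b} → b ≡ false → (z * ⟦ b ⟧) ≈ 0#
  x*⟦b⟧≈0 z refl = zeroʳ z

  x*⟦b⟧≈x : ∀ z {b} → b ≡ true → (z * ⟦ b ⟧) ≈ z
  x*⟦b⟧≈x z refl = *-identityʳ z

  0≤⟦b⟧ : ∀ b → 0# ≤ ⟦ b ⟧
  0≤⟦b⟧ true  = 0≤1
  0≤⟦b⟧ false = ≤-refl ≈-refl

  1≤⟦b⟧⇒b≡true : ∀ {b} → 1# ≤ ⟦ b ⟧ → b ≡ true
  1≤⟦b⟧⇒b≡true {true}  _   = refl
  1≤⟦b⟧⇒b≡true {false} 1≤0 = contradiction 1≤0 (<⇒≱ 0<1)

  ∑-nonneg : ∀ {k} {g : Fin k → Carrier} → (∀ a → 0# ≤ g a) → 0# ≤ ∑ g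
  ∑-nonneg {zero}  g≥0 = ≤-refl ≈-refl
  ∑-nonneg {suc k} g≥0 = 0≤x+y (g≥0 fzero) (∑-nonneg (λ a → g≥0 (fsuc a)))

  term≤∑ : ∀ {k} {g : Fin k → Carrier} → (∀ a → 0# ≤ g a) → ∀ a → g a ≤ ∑ g
  term≤∑ {suc k} {g} g≥0 fzero = begin
    g fzero      ≈⟨ +-identityʳ (g fzero) ⟨
    g fzero + 0# ≤⟨ +-monoʳ-≤ (g fzero) (∑-nonneg (λ a → g≥0 (fsuc a))) ⟩
    ∑ g          ∎
  term≤∑ {suc k} {g} g≥0 (fsuc a) = begin
    g (fsuc a)      ≈⟨ +-identityˡ (g (fsuc a)) ⟨
    0# + g (fsuc a) ≤⟨ +-mono₂-≤ (g≥0 fzero) (term≤∑ (λ b → g≥0 (fsuc b)) a) ⟩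
    ∑ g             ∎

  two-terms≤∑ : ∀ {k} {g : Fin k → Carrier} → (∀ a → 0# ≤ g a) →
                ∀ {a b} → a ≢ b → (g a + g b) ≤ ∑ g
  two-terms≤∑ {suc k} g≥0 {fzero} {fzero} a≢b = contradiction refl a≢b
  two-terms≤∑ {suc k} {g} g≥0 {fzero} {fsuc b} _ =
    +-monoʳ-≤ (g fzero) (term≤∑ (λ c → g≥0 (fsuc c)) b)
  two-terms≤∑ {suc k} {g} g≥0 {fsuc a} {fzero} _ =
    ≤-resp-≈ (+-comm (g fzero) (g (fsuc a))) ≈-refl (+-monoʳ-≤ (g fzero) (term≤∑ (λ c → g≥0 (fsuc c)) a))
  two-terms≤∑ {suc k} {g} g≥0 {fsuc a} {fsuc b} a≢b = begin
    g (fsuc a) + g (fsuc b)        ≈⟨ +-identityˡ _ ⟨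
    0# + (g (fsuc a) + g (fsuc b)) ≤⟨ +-mono₂-≤ (g≥0 fzero) (two-terms≤∑ (λ c → g≥0 (fsuc c)) (a≢b ∘ ≡.cong fsuc)) ⟩
    ∑ g                            ∎

  ∑-zero : ∀ {k} {g : Fin k → Carrier} → (∀ a → g a ≈ 0#) → ∑ g ≈ 0#
  ∑-zero {zero}  g≈0 = ≈-refl
  ∑-zero {suc k} g≈0 = ≈-trans (+-cong (g≈0 fzero) (∑-zero (λ a → g≈0 (fsuc a)))) (+-identityʳ 0#)

  ∑-single : ∀ {k} {g : Fin k → Carrier} a → (∀ b → b ≢ a → g b ≈ 0#) → ∑ g ≈ g a
  ∑-single {suc k} {g} fzero g≈0 =
    ≈-trans (+-congˡ (∑-zero (λ b → g≈0 (fsuc b) λ ()))) (+-identityʳ (g fzero))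
  ∑-single {suc k} {g} (fsuc a) g≈0 =
    ≈-trans (+-congʳ (g≈0 fzero λ ())) (≈-trans (+-identityˡ _)
      (∑-single a (λ b b≢a → g≈0 (fsuc b) (b≢a ∘ suc-injective))))

  ∑-if-single : ∀ {k} (p : Fin k → Bool) (g : Fin k → Carrier) {a} → p a ≡ true →
                (∀ b → b ≢ a → p b ≡ true → g b ≈ 0#) →
                ∑ (λ b → if p b then g b else 0#) ≈ g a
  ∑-if-single p g {a} pa g≈0 =
    ≈-trans (∑-single a term≈0) (reflexive (≡.cong (λ c → if c then g a else 0#) pa))
    where
    term≈0 : ∀ b → b ≢ a → (if p b then g b else 0#) ≈ 0#
    term≈0 b b≢a with p b in pb
    ... | true  = g≈0 b b≢a pb
    ... | false = ≈-refl

  two-terms≤∑∑ : ∀ {k} {G : Fin k → Fin k → Carrier} → (∀ a b → 0# ≤ G a b) →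
                 ∀ {a b a′ b′} → (a , b) ≢ (a′ , b′) →
                 (G a b + G a′ b′) ≤ ∑ (λ a → ∑ (G a))
  two-terms≤∑∑ {G = G} G≥0 {a} {b} {a′} {b′} ab≢a′b′ with a ≟ a′
  ... | yes refl = ≤-trans (two-terms≤∑ (G≥0 a) (λ b≡b′ → ab≢a′b′ (≡.cong (a ,_) b≡b′)))
                           (term≤∑ (λ c → ∑-nonneg (G≥0 c)) a)
  ... | no a≢a′ = ≤-trans (+-mono₂-≤ (term≤∑ (G≥0 a) b) (term≤∑ (G≥0 a′) b′))
                          (two-terms≤∑ (λ c → ∑-nonneg (G≥0 c)) a≢a′)

  term≤∑∑ : ∀ {k} {G : Fin k → Fin k → Carrier} → (∀ a b → 0# ≤ G a b) →
            ∀ a b → G a b ≤ ∑ (λ a → ∑ (G a))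
  term≤∑∑ G≥0 a b = ≤-trans (term≤∑ (G≥0 a) b) (term≤∑ (λ c → ∑-nonneg (G≥0 c)) a)

  module ZeroOneSum {k} (p q : Fin k → Bool) where

    Hit : Fin k → Set
    Hit a = p a ≡ true × q a ≡ true

    term : Fin k → Carrier
    term a = if p a then ⟦ q a ⟧ else 0#

    term-nonneg : ∀ a → 0# ≤ term a
    term-nonneg a with p a
    ... | true  = 0≤⟦b⟧ (q a)
    ... | false = ≤-refl ≈-refl

    term-hit : ∀ {a} → Hit a → term a ≡ 1#
    term-hit (pa , qa) rewrite pa | qa = refl

    term-miss : ∀ {a} → ¬ Hit a → term a ≈ 0#
    term-miss {a} ¬hit with p a | q a
    ... | true  | true  = contradiction (refl , refl) ¬hit
    ... | true  | false = ≈-refl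
    ... | false | _     = ≈-refl

    hit⇒1≤∑ : ∀ {a} → Hit a → 1# ≤ ∑ term
    hit⇒1≤∑ {a} hit = ≤-resp-≈ (reflexive (term-hit hit)) ≈-refl (term≤∑ term-nonneg a)

    ∑≈0⇒¬hit : ∀ {a} → ∑ term ≈ 0# → ¬ Hit a
    ∑≈0⇒¬hit ∑≈0 hit = <⇒≱ 0<1 (≤-resp-≈ ≈-refl ∑≈0 (hit⇒1≤∑ hit))

    ¬hit⇒∑≈0 : (∀ a → ¬ Hit a) → ∑ term ≈ 0#
    ¬hit⇒∑≈0 ¬hit = ∑-zero (λ a → term-miss (¬hit a))

    ∑≈1⇒hit-unique : ∀ {a b} → ∑ term ≈ 1# → Hit a → Hit b → a ≡ b
    ∑≈1⇒hit-unique {a} {b} ∑≈1 hitᵃ hitᵇ with a ≟ b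
    ... | yes a≡b = a≡b
    ... | no  a≢b = contradiction 2≤1 (<⇒≱ 1<1+1)
      where
      2≤1 : (1# + 1#) ≤ 1#
      2≤1 = begin
        1# + 1#         ≡⟨ ≡.cong₂ _+_ (term-hit hitᵃ) (term-hit hitᵇ) ⟨
        term a + term b ≤⟨ two-terms≤∑ term-nonneg a≢b ⟩
        ∑ term          ≈⟨ ∑≈1 ⟩
        1#              ∎

module FeasibleSolution {c ℓ₁ ℓ₂} (F : OrderedField c ℓ₁ ℓ₂) {n : ℕ}
  (arc : Fin n → Fin n → Bool) (d : Fin n → Fin n → OrderedField.Carrier F)
  (s t : Fin n) (s≢t : s ≢ t)
  (d-pos : ∀ i j → arc i j ≡ true → OrderedField._<_ F (OrderedField.0# F) (d i j))
  {mand : Fin n → Bool} {m : ℕ} {T : OrderedField.Carrier F}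
  {R : Fin n → Fin n → OrderedField.Carrier F}
  {x : Fin n → Fin n → Bool} {y : Fin n → Bool}
  {f : Fin n → Fin n → OrderedField.Carrier F} {φ : OrderedField.Carrier F}
  (feasible : STOP.Feasible F arc d s t mand m T R x y f φ) where

  open OrderedField F hiding (zero) renaming (refl to ≈-refl; sym to ≈-sym; trans to ≈-trans)
  open OrderedFieldProperties F
  open STOP F arc d s t
  open Feasible feasible

  Used : Fin n → Fin n → Set
  Used a b = arc a b ≡ true × x a b ≡ true

  used? : ∀ a b → Dec (Used a b)
  used? a b = (arc a b Bool.≟ true) ×-dec (x a b Bool.≟ true)

  Visited : Fin n → Set
  Visited v = v ≢ s × v ≢ t × y v ≡ true

  module Out (v : Fin n) = ZeroOneSum (arc v) (x v)
  module In  (v : Fin n) = ZeroOneSum (λ a → arc a v) (λ a → x a v)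

  used⇒source≢t : ∀ {a b} → Used a b → a ≢ t
  used⇒source≢t used refl = Out.∑≈0⇒¬hit t out-t used

  used⇒target≢s : ∀ {a b} → Used a b → b ≢ s
  used⇒target≢s used refl = In.∑≈0⇒¬hit s in-s used

  out≈in : ∀ {v} → v ≢ s → v ≢ t → out∑ X v ≈ in∑ X v
  out≈in v≢s v≢t = x∙y⁻¹≈ε⇒x≈y _ _ (balance _ v≢s v≢t)

  used⇒source-visited : ∀ {a b} → Used a b → a ≢ s → Visited a
  used⇒source-visited {a} used a≢s =
    a≢s , a≢t , 1≤⟦b⟧⇒b≡true (≤-resp-≈ ≈-refl (degree a a≢s a≢t) (Out.hit⇒1≤∑ a used))
    where
    a≢t : a ≢ t
    a≢t = used⇒source≢t used

  used⇒target-visited : ∀ {a b} → Used a b → b ≢ t → Visited b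
  used⇒target-visited {b = b} used b≢t = b≢s , b≢t , 1≤⟦b⟧⇒b≡true (begin
    1#       ≤⟨ In.hit⇒1≤∑ b used ⟩
    in∑ X b  ≈⟨ out≈in b≢s b≢t ⟨
    out∑ X b ≈⟨ degree b b≢s b≢t ⟩
    ⟦ y b ⟧  ∎)
    where
    b≢s : b ≢ s
    b≢s = used⇒target≢s used

  out-degree : ∀ {v} → Visited v → out∑ X v ≈ 1#
  out-degree {v} (v≢s , v≢t , yv) = ≈-trans (degree v v≢s v≢t) (reflexive (≡.cong ⟦_⟧ yv))

  in-degree : ∀ {v} → Visited v → in∑ X v ≈ 1#
  in-degree visited@(v≢s , v≢t , _) = ≈-trans (≈-sym (out≈in v≢s v≢t)) (out-degree visited)

  succ : Fin n → Fin n
  succ v with any? (used? v)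
  ... | yes (b , _) = b
  ... | no  _       = v

  succ-used : ∀ {v} → Visited v → Used v (succ v)
  succ-used {v} visited with any? (used? v)
  ... | yes (_ , used) = used
  ... | no  ¬used      =
    contradiction (≈-trans (≈-sym (Out.¬hit⇒∑≈0 v (λ b → ¬used ∘ (b ,_)))) (out-degree visited)) 0≉1

  succ-unique : ∀ {v b} → Visited v → Used v b → succ v ≡ b
  succ-unique {v} visited used = Out.∑≈1⇒hit-unique v (out-degree visited) (succ-used visited) used

  pred : Fin n → Fin n
  pred v with any? (λ a → used? a v)
  ... | yes (a , _) = a
  ... | no  _       = v

  pred-used : ∀ {v} → Visited v → Used (pred v) v
  pred-used {v} visited with any? (λ a → used? a v)
  ... | yes (_ , used) = used
  ... | no  ¬used      =
    contradiction (≈-trans (≈-sym (In.¬hit⇒∑≈0 v (λ a → ¬used ∘ (a ,_)))) (in-degree visited)) 0≉1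

  pred-unique : ∀ {a v} → Visited v → Used a v → pred v ≡ a
  pred-unique {v = v} visited used = In.∑≈1⇒hit-unique v (in-degree visited) (pred-used visited) used

  x≡false-off-pred : ∀ {a v} → Visited v → arc a v ≡ true → a ≢ pred v → x a v ≡ false
  x≡false-off-pred visited arcᵃᵛ a≢pred = ¬-not (λ xᵃᵛ → a≢pred (≡.sym (pred-unique visited (arcᵃᵛ , xᵃᵛ))))

  x≡false-off-succ : ∀ {v b} → Visited v → arc v b ≡ true → b ≢ succ v → x v b ≡ false
  x≡false-off-succ visited arcᵛᵇ b≢succ = ¬-not (λ xᵛᵇ → b≢succ (≡.sym (succ-unique visited (arcᵛᵇ , xᵛᵇ))))

  f-unused : ∀ {a b} → arc a b ≡ true → x a b ≡ false → f a b ≈ 0#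
  f-unused {a} {b} arcᵃᵇ xᵃᵇ with a ≟ s
  ... | yes refl = ≈-trans (f-s b arcᵃᵇ) (x*⟦b⟧≈0 _ xᵃᵇ)
  ... | no  a≢s  = ≤-antisym (≤-resp-≈ ≈-refl (x*⟦b⟧≈0 _ xᵃᵇ) (f-upper a b arcᵃᵇ a≢s)) (f-nonneg a b arcᵃᵇ)

  flow-conservation : ∀ {v} → Visited v → f (pred v) v ≈ (f v (succ v) + d v (succ v))
  flow-conservation {v} visited@(v≢s , v≢t , _) = x-y≈z⇒x≈y+z (begin-equality
    f (pred v) v - f v (succ v)   ≈⟨ +-cong inflow (-‿cong outflow) ⟨
    in∑ f v - out∑ f v            ≈⟨ f-cons v v≢s v≢t ⟩
    out∑ (λ a b → d a b * X a b) v ≈⟨ outtime ⟩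
    d v (succ v)                  ∎)
    where
    inflow : in∑ f v ≈ f (pred v) v
    inflow = ∑-if-single (λ a → arc a v) (λ a → f a v) (proj₁ (pred-used visited))
      (λ a a≢pred arcᵃᵛ → f-unused arcᵃᵛ (x≡false-off-pred visited arcᵃᵛ a≢pred))
    outflow : out∑ f v ≈ f v (succ v)
    outflow = ∑-if-single (arc v) (f v) (proj₁ (succ-used visited))
      (λ b b≢succ arcᵛᵇ → f-unused arcᵛᵇ (x≡false-off-succ visited arcᵛᵇ b≢succ))
    outtime : out∑ (λ a b → d a b * X a b) v ≈ d v (succ v)
    outtime = ≈-trans
      (∑-if-single (arc v) (λ b → d v b * X v b) (proj₁ (succ-used visited))
        (λ b b≢succ arcᵛᵇ → x*⟦b⟧≈0 (d v b) (x≡false-off-succ visited arcᵛᵇ b≢succ)))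
      (x*⟦b⟧≈x (d v (succ v)) (proj₂ (succ-used visited)))

  flow-decreases : ∀ {v} → Visited v → f v (succ v) < f (pred v) v
  flow-decreases {v} visited = begin-strict
    f v (succ v)                <⟨ x<x+y (d-pos v (succ v) (proj₁ (succ-used visited))) ⟩
    f v (succ v) + d v (succ v) ≈⟨ flow-conservation visited ⟨
    f (pred v) v                ∎

  -- Split so that the head of walk k v is visible without case analysis on k.
  walk walkTail : ℕ → Fin n → List (Fin n)
  walk k v = v ∷ walkTail k v
  walkTail zero    v = []
  walkTail (suc k) v = walk k (succ v)

  Run : ℕ → Fin n → Set
  Run zero    v = ⊤
  Run (suc k) v = Visited v × Run k (succ v)

  Reaches : ℕ → Fin n → Set
  Reaches zero    v = v ≡ t
  Reaches (suc k) v = Visited v × Reaches k (succ v)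

  reaches⇒run : ∀ k {v} → Reaches k v → Run k v
  reaches⇒run zero    _                = tt
  reaches⇒run (suc k) (visited , reach) = visited , reaches⇒run k reach

  length-walk : ∀ k v → length (walk k v) ≡ suc k
  length-walk zero    v = refl
  length-walk (suc k) v = ≡.cong suc (length-walk k (succ v))

  walk-visited-or-t : ∀ k {a w u} → Used a w → Run k w → u ∈ walk k w → u ≡ t ⊎ Visited u
  walk-visited-or-t zero {w = w} used _ (here refl) with w ≟ t
  ... | yes w≡t = inj₁ w≡t
  ... | no  w≢t = inj₂ (used⇒target-visited used w≢t)
  walk-visited-or-t (suc k) _ (visited , _)   (here refl) = inj₂ visited
  walk-visited-or-t (suc k) _ (visited , run) (there u∈)  = walk-visited-or-t k (succ-used visited) run u∈

  inflow-unique : ∀ {a v} → Visited v → Used a v → f (pred v) v ≡ f a v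
  inflow-unique visited used = ≡.cong (λ a → f a _) (pred-unique visited used)

  walk-inflow≤ : ∀ k {a w u} → Used a w → Run k w → u ∈ walk k w → Visited u → f (pred u) u ≤ f a w
  walk-inflow≤ k       used _ (here refl) visited = ≤-refl (reflexive (inflow-unique visited used))
  walk-inflow≤ (suc k) {a} {w} used (visitedʷ , run) (there u∈) visited = begin
    f (pred _) _ ≤⟨ walk-inflow≤ k (succ-used visitedʷ) run u∈ visited ⟩
    f w (succ w) <⟨ flow-decreases visitedʷ ⟩
    f (pred w) w ≡⟨ inflow-unique visitedʷ used ⟩
    f a w        ∎

  walk-unique : ∀ k {a w} → Used a w → Run k w → Unique (walk k w)
  walk-unique zero    _    _               = All.[] ∷ []
  walk-unique (suc k) used (visited , run) = All.tabulate w∉ ∷ walk-unique k (succ-used visited) run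
    where
    w∉ : ∀ {z} → z ∈ walk k (succ _) → _ ≢ z
    w∉ z∈ refl with walk-visited-or-t k (succ-used visited) run z∈
    ... | inj₁ w≡t = proj₁ (proj₂ visited) w≡t
    ... | inj₂ _   = <⇒≱ (flow-decreases visited) (walk-inflow≤ k (succ-used visited) run z∈ visited)

  run-length< : ∀ k {a w} → Used a w → Run k w → k <ℕ n
  run-length< k {w = w} used run = ≡.subst (_≤ℕ n) (length-walk k w) (Unique⇒length≤ (walk-unique k used run))

  reaches-or-run : ∀ r {a w} → Used a w → (∃ λ k → Reaches k w) ⊎ Run r w
  reaches-or-run zero                  _    = inj₂ tt
  reaches-or-run (suc r) {w = w} used with w ≟ t
  ... | yes w≡t = inj₁ (zero , w≡t)
  ... | no  w≢t = Sum.map (Product.map suc (visited ,_)) (visited ,_) (reaches-or-run r (succ-used visited))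
    where
    visited : Visited w
    visited = used⇒target-visited used w≢t

  reaches-t : ∀ {a w} → Used a w → ∃ λ k → Reaches k w
  reaches-t used with reaches-or-run n used
  ... | inj₁ reach = reach
  ... | inj₂ run   = contradiction (run-length< n used run) (ℕₚ.<-irrefl refl)

  -- Walks through visited vertices have fewer than n steps, so the fuel r never runs out.
  extend-back : ∀ r {v k u} → n ≤ℕ r ℕ.+ k → Visited v → Reaches k v → u ∈ walk k v →
                ∃₂ λ w k → Used s w × Reaches k w × u ∈ walk k w
  extend-back zero {k = k} n≤k visited reach _ =
    contradiction n≤k (ℕₚ.<⇒≱ (run-length< k (pred-used visited) (reaches⇒run k reach)))
  extend-back (suc r) {v} {k} n≤r+k visited reach u∈ with pred v ≟ s
  ... | yes pred≡s = v , k , ≡.subst (λ a → Used a v) pred≡s (pred-used visited) , reach , u∈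
  ... | no  pred≢s = extend-back r (≡.subst (n ≤ℕ_) (≡.sym (ℕₚ.+-suc r k)) n≤r+k) visitedᵖ
                       (visitedᵖ , ≡.subst (Reaches k) (≡.sym succ-pred) reach)
                       (there (≡.subst (λ z → _ ∈ walk k z) (≡.sym succ-pred) u∈))
    where
    visitedᵖ : Visited (pred v)
    visitedᵖ = used⇒source-visited (pred-used visited) pred≢s
    succ-pred : succ (pred v) ≡ v
    succ-pred = succ-unique visitedᵖ (pred-used visited)

  route-through : ∀ {u} → Visited u → ∃₂ λ w k → Used s w × Reaches k w × u ∈ walk k w
  route-through {u} visited with reaches-t (pred-used visited)
  ... | k , reach = extend-back n (ℕₚ.m≤m+n n k) visited reach (here refl)

  reaches-unique : ∀ k k′ {v} → Reaches k v → Reaches k′ v → k ≡ k′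
  reaches-unique zero    zero     _           _            = refl
  reaches-unique zero    (suc k′) v≡t         (visited , _) = contradiction v≡t (proj₁ (proj₂ visited))
  reaches-unique (suc k) zero     (visited , _) v≡t        = contradiction v≡t (proj₁ (proj₂ visited))
  reaches-unique (suc k) (suc k′) (_ , reach) (_ , reach′) = ≡.cong suc (reaches-unique k k′ reach reach′)

  walk-linked : ∀ k {v w} → arc v w ≡ true → Reaches k w → Linked (λ a b → arc a b ≡ true) (v ∷ walk k w)
  walk-linked zero    arcᵛʷ _                 = arcᵛʷ ∷ [-]
  walk-linked (suc k) arcᵛʷ (visited , reach) = arcᵛʷ ∷ walk-linked k (proj₁ (succ-used visited)) reach

  last-walk : ∀ k {v w} → Reaches k w → last (v ∷ walk k w) ≡ just t
  last-walk zero              w≡t         = ≡.cong just w≡t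
  last-walk (suc k) {w = w} (_ , reach) = last-walk k {w} reach

  walk-time≤ : ∀ k {v a w} → Used a w → Reaches k w → time (v ∷ walk k w) ≤ (d v w + f a w)
  walk-time≤ zero    {v} {a} {w} used _ = +-monoʳ-≤ (d v w) (f-nonneg a w (proj₁ used))
  walk-time≤ (suc k) {v} {a} {w} used (visited , reach) = begin
    d v w + time (w ∷ walk k (succ w))      ≤⟨ +-monoʳ-≤ (d v w) (walk-time≤ k (succ-used visited) reach) ⟩
    d v w + (d w (succ w) + f w (succ w))   ≈⟨ +-congˡ (+-comm _ _) ⟩
    d v w + (f w (succ w) + d w (succ w))   ≈⟨ +-congˡ (flow-conservation visited) ⟨
    d v w + f (pred w) w                    ≡⟨ ≡.cong (d v w +_) (inflow-unique visited used) ⟩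
    d v w + f a w                           ∎

  route : ∀ k {w} → Used s w → Reaches k w → IsRoute (s ∷ walk k w)
  route k {w} used reach =
    (All.tabulate s∉ ∷ walk-unique k used run , walk-linked k (proj₁ used) reach) , refl , last-walk k {s} reach
    where
    run : Run k w
    run = reaches⇒run k reach
    s∉ : ∀ {z} → z ∈ walk k w → s ≢ z
    s∉ z∈ refl with walk-visited-or-t k used run z∈
    ... | inj₁ s≡t       = s≢t s≡t
    ... | inj₂ (s≢s , _) = s≢s refl

  route-time≤T : ∀ k {w} → Used s w → Reaches k w → time (s ∷ walk k w) ≤ T
  route-time≤T k {w} used reach = begin
    time (s ∷ walk k w) ≤⟨ walk-time≤ k used reach ⟩
    d s w + f s w       ≈⟨ +-congˡ (≈-trans (f-s w (proj₁ used)) (x*⟦b⟧≈x _ (proj₂ used))) ⟩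
    d s w + (T - d s w) ≈⟨ x+[y-x]≈y (d s w) T ⟩
    T                   ∎

  module Cut (V : Fin n → Bool) (V-s : V s ≡ false) where

    Enters : Fin n → Fin n → Set
    Enters a b = Used a b × V a ≡ false × V b ≡ true

    summand : Fin n → Fin n → Carrier
    summand a b = if arc a b ∧ not (V a) ∧ V b then ⟦ x a b ⟧ else 0#

    summand-nonneg : ∀ a b → 0# ≤ summand a b
    summand-nonneg a b with arc a b ∧ not (V a) ∧ V b
    ... | true  = 0≤⟦b⟧ (x a b)
    ... | false = ≤-refl ≈-refl

    summand-enters : ∀ {a b} → Enters a b → summand a b ≡ 1#
    summand-enters ((arcᵃᵇ , xᵃᵇ) , Va , Vb) rewrite arcᵃᵇ | Va | Vb | xᵃᵇ = refl

    cut-nonneg : 0# ≤ cutIn V x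
    cut-nonneg = ∑-nonneg (λ a → ∑-nonneg (summand-nonneg a))

    record EntryArc (k : ℕ) (w u : Fin n) : Set where
      field
        from to : Fin n
        enters  : Enters from to
        steps   : ℕ
        reaches : Reaches steps to
        member  : u ∈ walk steps to
        suffix  : walk steps to ⊆ walk k w

    open EntryArc

    entry-here : ∀ k {a w u} → Enters a w → Reaches k w → u ∈ walk k w → EntryArc k w u
    entry-here k {a} {w} enters reach u∈ = record
      { from = a ; to = w ; enters = enters ; steps = k ; reaches = reach ; member = u∈ ; suffix = λ z∈ → z∈ }

    entry-arc : ∀ k {a w u} → Used a w → V a ≡ false → Reaches k w → u ∈ walk k w → V u ≡ true → EntryArc k w u
    entry-arc k used Va reach (here refl) Vu = entry-here k (used , Va , Vu) reach (here refl)
    entry-arc (suc k) {w = w} used Va (visited , reach) (there u∈) Vu with V w in Vw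
    ... | true  = entry-here (suc k) (used , Va , Vw) (visited , reach) (there u∈)
    ... | false = record { EntryArc e hiding (suffix) ; suffix = there ∘ suffix e }
      where
      e : EntryArc k (succ w) _
      e = entry-arc k (succ-used visited) Vw reach u∈ Vu

    crossing : ∀ {u} → Visited u → V u ≡ true → ∃₂ λ w k → Used s w × Reaches k w × EntryArc k w u
    crossing visited Vu with route-through visited
    ... | w , k , used , reach , u∈ = w , k , used , reach , entry-arc k used V-s reach u∈ Vu

    shared-entry : ∀ {k w u k′ w′ u′} (e : EntryArc k w u) (e′ : EntryArc k′ w′ u′) → to e ≡ to e′ → u′ ∈ walk k w
    shared-entry record { steps = l ; reaches = r ; suffix = sub }
                 record { steps = l′ ; reaches = r′ ; member = m′ } refl
      with reaches-unique l l′ r r′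
    ... | refl = sub m′

    visited⇒1≤cut : ∀ {u} → Visited u → V u ≡ true → 1# ≤ cutIn V x
    visited⇒1≤cut visited Vu with crossing visited Vu
    ... | _ , _ , _ , _ , e =
      ≤-resp-≈ (reflexive (summand-enters (enters e))) ≈-refl (term≤∑∑ summand-nonneg (from e) (to e))

    visited⇒2≤cut : ∀ {i j} → (∀ ps → IsRoute ps → i ∈ ps → j ∈ ps → T < time ps) →
                    Visited i → Visited j → V i ≡ true → V j ≡ true → (1# + 1#) ≤ cutIn V x
    visited⇒2≤cut overtime visitedⁱ visitedʲ Vi Vj with crossing visitedⁱ Vi | crossing visitedʲ Vj
    ... | w , k , used , reach , e | _ , _ , _ , _ , e′ with to e ≟ to e′
    ... | yes same = contradiction (route-time≤T k used reach)
                       (<⇒≱ (overtime (s ∷ walk k w) (route k used reach)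
                               (there (suffix e (member e))) (there (shared-entry e e′ same))))
    ... | no differ = begin
      1# + 1#
        ≡⟨ ≡.cong₂ _+_ (summand-enters (enters e)) (summand-enters (enters e′)) ⟨
      summand (from e) (to e) + summand (from e′) (to e′)
        ≤⟨ two-terms≤∑∑ summand-nonneg (differ ∘ ≡.cong proj₂) ⟩
      cutIn V x ∎

    cut-bound : ∀ {i j} → Conflicting T i j → V i ≡ true → V j ≡ true → (⟦ y i ⟧ + ⟦ y j ⟧) ≤ cutIn V x
    cut-bound {i} {j} (i≢s , i≢t , j≢s , j≢t , _ , overtime) Vi Vj with y i in yi | y j in yj
    ... | false | false = ≤-resp-≈ (≈-sym (+-identityʳ 0#)) ≈-refl cut-nonneg
    ... | true  | false = ≤-resp-≈ (≈-sym (+-identityʳ 1#)) ≈-refl (visited⇒1≤cut (i≢s , i≢t , yi) Vi)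
    ... | false | true  = ≤-resp-≈ (≈-sym (+-identityˡ 1#)) ≈-refl (visited⇒1≤cut (j≢s , j≢t , yj) Vj)
    ... | true  | true  = visited⇒2≤cut overtime (i≢s , i≢t , yi) (j≢s , j≢t , yj) Vi Vj

proposition2 : ∀ {c ℓ₁ ℓ₂ : Level} (F : OrderedField c ℓ₁ ℓ₂) (n : ℕ)
    (arc : Fin n → Fin n → Bool) (d : Fin n → Fin n → OrderedField.Carrier F)
    (s t : Fin n) (mand : Fin n → Bool) (m : ℕ) (T : OrderedField.Carrier F)
    (R : Fin n → Fin n → OrderedField.Carrier F) →
    s ≢ t →
    (∀ i j → arc i j ≡ true → OrderedField._<_ F (OrderedField.0# F) (d i j)) →
    1 ≤ℕ m →
    (∀ i → STOP.IsMinTime F arc d s t s i (R s i)) →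
    (∀ i → STOP.IsMinTime F arc d s t i t (R i t)) →
    ∀ (x : Fin n → Fin n → Bool) (y : Fin n → Bool)
    (f : Fin n → Fin n → OrderedField.Carrier F) (φ : OrderedField.Carrier F) →
    STOP.Feasible F arc d s t mand m T R x y f φ →
    ∀ (i j : Fin n) → STOP.Conflicting F arc d s t T i j →
    ∀ (V : Fin n → Bool) → V s ≡ false → V i ≡ true → V j ≡ true →
    OrderedField._≤_ F
    (OrderedField._+_ F (OrderedField.⟦_⟧ F (y i)) (OrderedField.⟦_⟧ F (y j)))
    (STOP.cutIn F arc d s t V x)
proposition2 F n arc d s t _ _ _ _ s≢t d-pos _ _ _ _ _ _ _ feasible _ _ conflict V V-s V-i V-j =
  FeasibleSolution.Cut.cut-bound F arc d s t s≢t d-pos feasible V V-s conflict V-i V-j
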